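{- Let $A$ be a local $\overline E$-algebra. If $P,P'\in(G/P_{\mathrm{sub}})(A)$ are parabolic subgroups of $G_A$ such that $\mathfrak{p}_2=\mathfrak{p}'_2$ as submodules of $\mathfrak{gl}_3(A)$, then $P=P'$.
   Context: $E/\mathbb{Q}_p$ finite; $G=\mathrm{GL}_3$. $P_{\mathrm{sub}}\subset G$ is the parabolic of invertible matrices whose $(2,1)$, $(2,3)$, $(3,1)$ entries vanish, and $\mathfrak{g}_2$ is the line spanned by $E_{12}$. For $P=gP_{\mathrm{sub}}g^{ -1}$, $\mathfrak{p}_2=\mathrm{Ad}(g)\mathfrak{g}_2$ (and similarly $\mathfrak{p}'_2$ for $P'$). -}

module Defs where

open import Level using (Level; _⊔_)
open import Data.Fin using (Fin; zero; suc)
open import Data.Product using (Σ; ∃; _×_; _,_)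
open import Data.Sum using (_⊎_)
open import Relation.Nullary using (¬_)
open import Function.Bundles using (_⇔_)
open import Algebra.Bundles using (CommutativeRing)
open import Algebra.Morphism.Structures using (IsRingHomomorphism)

private
  variable
    c ℓ : Level

Mat3 : CommutativeRing c ℓ → Set c
Mat3 R = Fin 3 → Fin 3 → CommutativeRing.Carrier R

module _ (R : CommutativeRing c ℓ) where
  open CommutativeRing R using (Carrier; _≈_; _+_; _*_; _-_; 0#; 1#)

  _⊗_ : Mat3 R → Mat3 R → Mat3 R
  (m ⊗ n) i j = m i zero * n zero j + (m i (suc zero) * n (suc zero) j
                  + m i (suc (suc zero)) * n (suc (suc zero)) j)

  _⊙_ : Carrier → Mat3 R → Mat3 R
  (a ⊙ m) i j = a * m i j

  _≋_ : Mat3 R → Mat3 R → Set ℓ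
  m ≋ n = ∀ i j → m i j ≈ n i j

  I3 : Mat3 R
  I3 zero zero = 1#
  I3 (suc zero) (suc zero) = 1#
  I3 (suc (suc zero)) (suc (suc zero)) = 1#
  I3 _ _ = 0#

  -- elementary matrix E_12 (0-based indices: row 0, column 1)
  E12 : Mat3 R
  E12 zero (suc zero) = 1#
  E12 _ _ = 0#

  IsInverse : Mat3 R → Mat3 R → Set ℓ
  IsInverse g m = ((g ⊗ m) ≋ I3) × ((m ⊗ g) ≋ I3)

  IsInvertible : Mat3 R → Set (c ⊔ ℓ)
  IsInvertible g = Σ (Mat3 R) (IsInverse g)

  -- A local ring (standard constructive definition): 0 ≠ 1 and for every x,
  -- x or 1 - x is a unit.
  IsUnit : Carrier → Set (c ⊔ ℓ)
  IsUnit x = ∃ λ y → x * y ≈ 1#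

  record IsLocal : Set (c ⊔ ℓ) where
    field
      nontrivial : ¬ (0# ≈ 1#)
      unit-or-unit : ∀ x → IsUnit x ⊎ IsUnit (1# - x)

  -- P_sub(R): invertible matrices whose (2,1), (2,3), (3,1) entries vanish
  -- (1-based), i.e. entries (1,0), (1,2), (2,0) 0-based.
  InPsub : Mat3 R → Set (c ⊔ ℓ)
  InPsub m = IsInvertible m
             × (m (suc zero) zero ≈ 0#)
             × (m (suc zero) (suc (suc zero)) ≈ 0#)
             × (m (suc (suc zero)) zero ≈ 0#)

  -- An R-point of G/P_sub, for R local: a parabolic P = g P_sub g⁻¹ given by
  -- g ∈ GL_3(R) together with its inverse.
  record GL3 : Set (c ⊔ ℓ) where
    field
      mat : Mat3 R
      inv : Mat3 R
      isInv : IsInverse mat inv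

  -- p_2 = Ad(g) g_2 = R-span of g E_12 g⁻¹ (as a predicate on gl_3(R))
  p₂ : GL3 → Mat3 R → Set (c ⊔ ℓ)
  p₂ g X = ∃ λ a → X ≋ (a ⊙ ((GL3.mat g ⊗ E12) ⊗ GL3.inv g))

  _≐_ : (Mat3 R → Set (c ⊔ ℓ)) → (Mat3 R → Set (c ⊔ ℓ)) → Set (c ⊔ ℓ)
  S ≐ T = ∀ X → (S X → T X) × (T X → S X)

mapMat : (R : CommutativeRing c ℓ) (S : CommutativeRing c ℓ) →
         (CommutativeRing.Carrier R → CommutativeRing.Carrier S) → Mat3 R → Mat3 S
mapMat R S φ m i j = φ (m i j)

-- B-points of the parabolic P = g P_sub g⁻¹ (g an A-point, φ : A → B):
-- h ∈ P(B)  iff  φ(g)⁻¹ h φ(g) ∈ P_sub(B).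
InParabolic : (A B : CommutativeRing c ℓ) →
              (CommutativeRing.Carrier A → CommutativeRing.Carrier B) →
              GL3 A → Mat3 B → Set (c ⊔ ℓ)
InParabolic A B φ g h =
  InPsub B (_⊗_ B (_⊗_ B (mapMat A B φ (GL3.inv {R = A} g)) h) (mapMat A B φ (GL3.mat {R = A} g)))

-- Equality P = P' of subgroup schemes of G_A: equality of B-points for every
-- commutative A-algebra B.
SameParabolic : (A : CommutativeRing c ℓ) → GL3 A → GL3 A → Set _
SameParabolic {c} {ℓ} A g g' =
  (B : CommutativeRing c ℓ)
  (φ : CommutativeRing.Carrier A → CommutativeRing.Carrier B) →
  IsRingHomomorphism (CommutativeRing.rawRing A) (CommutativeRing.rawRing B) φ →
  (h : Mat3 B) → InParabolic A B φ g h ⇔ InParabolic A B φ g' h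

module Submission where

-- Write P = g P_sub g⁻¹, P' = h P_sub h⁻¹ and let k = g⁻¹h be the transporter.
-- * 3×3 matrices over a commutative ring form a monoid (MatrixAlgebra), so the
--   bookkeeping with inverses is done once, in any monoid (Conjugation).
-- * The shape of P_sub is closed under products, hence conjugation by a k such
--   that k and k⁻¹ have this shape preserves P_sub (InPsub-conj); so
--   g P_sub g⁻¹ ⊆ h P_sub h⁻¹ as soon as g⁻¹h and h⁻¹g have the shape of P_sub
--   (GeneralLinear.conjugate-inclusion).
-- * If Ad(h)E₁₂ = a·Ad(g)E₁₂ then k E₁₂ = a E₁₂ k; comparing entries gives
--   k₁₀ = k₂₀ = 0 and a k₁₂ = 0 (Lines.intertwiner-shape).
-- * p₂ = p'₂ gives Ad(h)E₁₂ = a·Ad(g)E₁₂ and Ad(g)E₁₂ = b·Ad(h)E₁₂, so E₁₂ = ab E₁₂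
--   and a is a unit; hence k, and symmetrically h⁻¹g, have the shape of P_sub
--   (Lines.equal-lines⇒transporter-shape).
-- * These shape conditions survive base change along any A → B (BaseChange), which
--   gives P(B) = P'(B) for every A-algebra B.

open import Defs
open import Level using (Level)
open import Algebra.Bundles using (CommutativeRing; Monoid)
open import Algebra.Morphism.Structures using (IsRingHomomorphism)
open import Data.Fin using (Fin; zero; suc; #_)
open import Data.Product using (_×_; _,_; proj₁; proj₂; swap)
open import Function.Bundles using (mk⇔)
import Algebra.Properties.CommutativeSemigroup as CommutativeSemigroupProperties
import Algebra.Properties.Monoid as MonoidProperties
import Relation.Binary.Reasoning.Setoid as SetoidReasoning

module RingFacts {c ℓ : Level} (R : CommutativeRing c ℓ) where
  open CommutativeRing R

  sum-of-zeros : ∀ {x y} → x ≈ 0# → y ≈ 0# → x + y ≈ 0#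
  sum-of-zeros p q = trans (+-cong p q) (+-identityˡ 0#)

  plus-zeros : ∀ {x y u} → x ≈ u → y ≈ 0# → x + y ≈ u
  plus-zeros {u = u} p q = trans (+-cong p q) (+-identityʳ u)

  zeros-plus : ∀ {x y u} → x ≈ 0# → y ≈ u → x + y ≈ u
  zeros-plus {u = u} p q = trans (+-cong p q) (+-identityˡ u)

  annihilateˡ : ∀ {x y} → x ≈ 0# → x * y ≈ 0#
  annihilateˡ {y = y} p = trans (*-congʳ p) (zeroˡ y)

  annihilateʳ : ∀ {x y} → y ≈ 0# → x * y ≈ 0#
  annihilateʳ {x = x} p = trans (*-congˡ p) (zeroʳ x)

  unit-cancel : ∀ {a x} → IsUnit R a → a * x ≈ 0# → x ≈ 0#
  unit-cancel {a} {x} (b , ab≈1) ax≈0 = begin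
    x            ≈⟨ sym (*-identityˡ x) ⟩
    1# * x       ≈⟨ *-congʳ (sym (trans (*-comm b a) ab≈1)) ⟩
    (b * a) * x  ≈⟨ *-assoc b a x ⟩
    b * (a * x)  ≈⟨ *-congˡ ax≈0 ⟩
    b * 0#       ≈⟨ zeroʳ b ⟩
    0#           ∎
    where open SetoidReasoning setoid

module Conjugation {c ℓ : Level} (M : Monoid c ℓ) where
  open Monoid M
  open MonoidProperties M
  open SetoidReasoning setoid

  conj-inverse : ∀ k k⁻ m n → k ∙ k⁻ ≈ ε → k⁻ ∙ k ≈ ε → m ∙ n ≈ ε →
                 ((k⁻ ∙ m) ∙ k) ∙ ((k⁻ ∙ n) ∙ k) ≈ ε
  conj-inverse k k⁻ m n kk⁻≈ε k⁻k≈ε mn≈ε = begin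
    ((k⁻ ∙ m) ∙ k) ∙ ((k⁻ ∙ n) ∙ k)  ≈⟨ ∙-congˡ (assoc k⁻ n k) ⟩
    ((k⁻ ∙ m) ∙ k) ∙ (k⁻ ∙ (n ∙ k))  ≈⟨ cancelᶜ kk⁻≈ε (k⁻ ∙ m) (n ∙ k) ⟩
    (k⁻ ∙ m) ∙ (n ∙ k)               ≈⟨ uv≈w⇒xu∙vy≈x∙wy mn≈ε k⁻ k ⟩
    k⁻ ∙ (ε ∙ k)                     ≈⟨ ∙-congˡ (identityˡ k) ⟩
    k⁻ ∙ k                           ≈⟨ k⁻k≈ε ⟩
    ε                                ∎

  change-conjugator : ∀ g g⁻ → g ∙ g⁻ ≈ ε → ∀ h h⁻ x →
                      (h⁻ ∙ x) ∙ h ≈ ((h⁻ ∙ g) ∙ ((g⁻ ∙ x) ∙ g)) ∙ (g⁻ ∙ h)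
  change-conjugator g g⁻ gg⁻≈ε h h⁻ x = sym (begin
    ((h⁻ ∙ g) ∙ ((g⁻ ∙ x) ∙ g)) ∙ (g⁻ ∙ h)  ≈⟨ ∙-congʳ (uv∙wx≈u[vw∙x] h⁻ g (g⁻ ∙ x) g) ⟩
    (h⁻ ∙ ((g ∙ (g⁻ ∙ x)) ∙ g)) ∙ (g⁻ ∙ h)  ≈⟨ ∙-congʳ (∙-congˡ (∙-congʳ (cancelˡ gg⁻≈ε x))) ⟩
    (h⁻ ∙ (x ∙ g)) ∙ (g⁻ ∙ h)              ≈⟨ ∙-congʳ (sym (assoc h⁻ x g)) ⟩
    ((h⁻ ∙ x) ∙ g) ∙ (g⁻ ∙ h)              ≈⟨ cancelᶜ gg⁻≈ε (h⁻ ∙ x) h ⟩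
    (h⁻ ∙ x) ∙ h                           ∎)

  unconjugateˡ : ∀ g g⁻ → g⁻ ∙ g ≈ ε → ∀ x z → (g⁻ ∙ ((g ∙ x) ∙ g⁻)) ∙ z ≈ x ∙ (g⁻ ∙ z)
  unconjugateˡ g g⁻ g⁻g≈ε x z = begin
    (g⁻ ∙ ((g ∙ x) ∙ g⁻)) ∙ z  ≈⟨ [u∙vw]x≈u[v∙wx] g⁻ (g ∙ x) g⁻ z ⟩
    g⁻ ∙ ((g ∙ x) ∙ (g⁻ ∙ z))  ≈⟨ ∙-congˡ (assoc g x (g⁻ ∙ z)) ⟩
    g⁻ ∙ (g ∙ (x ∙ (g⁻ ∙ z)))  ≈⟨ cancelˡ g⁻g≈ε (x ∙ (g⁻ ∙ z)) ⟩
    x ∙ (g⁻ ∙ z)               ∎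

  unconjugateʳ : ∀ h h⁻ → h⁻ ∙ h ≈ ε → ∀ x z → (z ∙ ((h ∙ x) ∙ h⁻)) ∙ h ≈ (z ∙ h) ∙ x
  unconjugateʳ h h⁻ h⁻h≈ε x z = begin
    (z ∙ ((h ∙ x) ∙ h⁻)) ∙ h  ≈⟨ assoc z ((h ∙ x) ∙ h⁻) h ⟩
    z ∙ (((h ∙ x) ∙ h⁻) ∙ h)  ≈⟨ ∙-congˡ (cancelʳ h⁻h≈ε (h ∙ x)) ⟩
    z ∙ (h ∙ x)               ≈⟨ sym (assoc z h x) ⟩
    (z ∙ h) ∙ x               ∎

module MatrixAlgebra {c ℓ : Level} (R : CommutativeRing c ℓ) where
  open CommutativeRing R
  open RingFacts R
  open CommutativeSemigroupProperties +-commutativeSemigroup using (interchange)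

  Mat : Set c
  Mat = Mat3 R

  infixl 7 _·_
  _·_ : Mat → Mat → Mat
  _·_ = _⊗_ R

  infixr 8 _⊛_
  _⊛_ : Carrier → Mat → Mat
  _⊛_ = _⊙_ R

  I E : Mat
  I = I3 R
  E = E12 R

  -- Entrywise equality, packed in a record so that the two matrices remain visible
  -- in its type instead of being unfolded into a family of equations.
  infix 4 _≈ₘ_
  record _≈ₘ_ (m n : Mat) : Set ℓ where
    constructor entrywise
    field entry : _≋_ R m n
  open _≈ₘ_ public

  -- Sums over the three indices; (m · n) i j is definitionally Σ₃ (λ k → m i k * n k j).
  Σ₃ : (Fin 3 → Carrier) → Carrier
  Σ₃ f = f (# 0) + (f (# 1) + f (# 2))

  Σ₃-cong : ∀ {f g} → (∀ k → f k ≈ g k) → Σ₃ f ≈ Σ₃ g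
  Σ₃-cong p = +-cong (p (# 0)) (+-cong (p (# 1)) (p (# 2)))

  Σ₃-distribʳ : ∀ f y → Σ₃ f * y ≈ Σ₃ (λ k → f k * y)
  Σ₃-distribʳ f y = trans (distribʳ y _ _) (+-congˡ (distribʳ y _ _))

  Σ₃-distribˡ : ∀ f y → y * Σ₃ f ≈ Σ₃ (λ k → y * f k)
  Σ₃-distribˡ f y = trans (distribˡ y _ _) (+-congˡ (distribˡ y _ _))

  Σ₃-swap : ∀ (f : Fin 3 → Fin 3 → Carrier) →
            Σ₃ (λ k → Σ₃ (λ l → f k l)) ≈ Σ₃ (λ l → Σ₃ (λ k → f k l))
  Σ₃-swap f = trans
    (+-congˡ (trans (interchange (f (# 1) (# 0)) _ (f (# 2) (# 0)) _)
                    (+-congˡ (interchange (f (# 1) (# 1)) _ (f (# 2) (# 1)) _))))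
    (trans (interchange (f (# 0) (# 0)) _ _ _) (+-congˡ (interchange (f (# 0) (# 1)) _ _ _)))

  ·-assoc : ∀ m n p → (m · n) · p ≈ₘ m · (n · p)
  ·-assoc m n p = entrywise λ i j → begin
    Σ₃ (λ k → Σ₃ (λ l → m i l * n l k) * p k j)
      ≈⟨ Σ₃-cong (λ k → Σ₃-distribʳ (λ l → m i l * n l k) (p k j)) ⟩
    Σ₃ (λ k → Σ₃ (λ l → (m i l * n l k) * p k j))
      ≈⟨ Σ₃-cong (λ k → Σ₃-cong (λ l → *-assoc (m i l) (n l k) (p k j))) ⟩
    Σ₃ (λ k → Σ₃ (λ l → m i l * (n l k * p k j)))
      ≈⟨ Σ₃-swap (λ k l → m i l * (n l k * p k j)) ⟩
    Σ₃ (λ l → Σ₃ (λ k → m i l * (n l k * p k j)))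
      ≈⟨ Σ₃-cong (λ l → sym (Σ₃-distribˡ (λ k → n l k * p k j) (m i l))) ⟩
    Σ₃ (λ l → m i l * Σ₃ (λ k → n l k * p k j))
      ∎
    where open SetoidReasoning setoid

  ·-cong : ∀ {m m' n n'} → m ≈ₘ m' → n ≈ₘ n' → m · n ≈ₘ m' · n'
  ·-cong p q = entrywise λ i j → Σ₃-cong (λ k → *-cong (entry p i k) (entry q k j))

  ·-congˡ : ∀ m {n n'} → n ≈ₘ n' → m · n ≈ₘ m · n'
  ·-congˡ m q = entrywise λ i j → Σ₃-cong (λ k → *-congˡ {m i k} (entry q k j))

  ·-congʳ : ∀ n {m m'} → m ≈ₘ m' → m · n ≈ₘ m' · n
  ·-congʳ n p = entrywise λ i j → Σ₃-cong (λ k → *-congʳ {n k j} (entry p i k))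

  ·-identityˡ : ∀ m → I · m ≈ₘ m
  ·-identityˡ m = entrywise row
    where
    row : _≋_ R (I · m) m
    row zero j             = plus-zeros (*-identityˡ _) (sum-of-zeros (zeroˡ _) (zeroˡ _))
    row (suc zero) j       = zeros-plus (zeroˡ _) (plus-zeros (*-identityˡ _) (zeroˡ _))
    row (suc (suc zero)) j = zeros-plus (zeroˡ _) (zeros-plus (zeroˡ _) (*-identityˡ _))

  ·-identityʳ : ∀ m → m · I ≈ₘ m
  ·-identityʳ m = entrywise column
    where
    column : _≋_ R (m · I) m
    column i zero             = plus-zeros (*-identityʳ _) (sum-of-zeros (zeroʳ _) (zeroʳ _))
    column i (suc zero)       = zeros-plus (zeroʳ _) (plus-zeros (*-identityʳ _) (zeroʳ _))
    column i (suc (suc zero)) = zeros-plus (zeroʳ _) (zeros-plus (zeroʳ _) (*-identityʳ _))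

  monoid : Monoid c ℓ
  monoid = record
    { Carrier  = Mat
    ; _≈_      = _≈ₘ_
    ; _∙_      = _·_
    ; ε        = I
    ; isMonoid = record
      { isSemigroup = record
        { isMagma = record
          { isEquivalence = record
            { refl  = entrywise λ i j → refl
            ; sym   = λ p → entrywise λ i j → sym (entry p i j)
            ; trans = λ p q → entrywise λ i j → trans (entry p i j) (entry q i j)
            }
          ; ∙-cong = ·-cong
          }
        ; assoc = ·-assoc
        }
      ; identity = ·-identityˡ , ·-identityʳ
      }
    }

  ⊛-congˡ : ∀ s {m n} → m ≈ₘ n → s ⊛ m ≈ₘ s ⊛ n
  ⊛-congˡ s q = entrywise λ i j → *-congˡ {s} (entry q i j)

  ⊛-assoc : ∀ s t m → s ⊛ (t ⊛ m) ≈ₘ (s * t) ⊛ m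
  ⊛-assoc s t m = entrywise λ i j → sym (*-assoc s t (m i j))

  ⊛-identity : ∀ m → m ≈ₘ 1# ⊛ m
  ⊛-identity m = entrywise λ i j → sym (*-identityˡ (m i j))

  ⊛-pull : ∀ s m x n → (m · (s ⊛ x)) · n ≈ₘ s ⊛ ((m · x) · n)
  ⊛-pull s m x n = entrywise λ i j → begin
    Σ₃ (λ k → Σ₃ (λ l → m i l * (s * x l k)) * n k j)
      ≈⟨ Σ₃-cong (λ k → *-congʳ {n k j} (Σ₃-cong (λ l → swap-scalar (m i l) (x l k)))) ⟩
    Σ₃ (λ k → Σ₃ (λ l → s * (m i l * x l k)) * n k j)
      ≈⟨ Σ₃-cong (λ k → *-congʳ {n k j} (sym (Σ₃-distribˡ (mx i k) s))) ⟩
    Σ₃ (λ k → (s * Σ₃ (mx i k)) * n k j)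
      ≈⟨ Σ₃-cong (λ k → *-assoc s (Σ₃ (mx i k)) (n k j)) ⟩
    Σ₃ (λ k → s * (Σ₃ (mx i k) * n k j))
      ≈⟨ sym (Σ₃-distribˡ (λ k → Σ₃ (mx i k) * n k j) s) ⟩
    s * Σ₃ (λ k → Σ₃ (mx i k) * n k j)
      ∎
    where
    open SetoidReasoning setoid
    mx : Fin 3 → Fin 3 → Fin 3 → Carrier
    mx i k l = m i l * x l k
    swap-scalar : ∀ a b → a * (s * b) ≈ s * (a * b)
    swap-scalar a b = trans (sym (*-assoc a s b)) (trans (*-congʳ (*-comm a s)) (*-assoc s a b))

  open Monoid monoid using () renaming (trans to ≈ₘ-trans)
  open Conjugation monoid using (conj-inverse)

  PsubShape : Mat → Set ℓ
  PsubShape m = (m (# 1) (# 0) ≈ 0#) × (m (# 1) (# 2) ≈ 0#) × (m (# 2) (# 0) ≈ 0#)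

  PsubShape-resp : ∀ {m n} → m ≈ₘ n → PsubShape n → PsubShape m
  PsubShape-resp m≈n (n₁₀ , n₁₂ , n₂₀) =
    trans (entry m≈n (# 1) (# 0)) n₁₀ , trans (entry m≈n (# 1) (# 2)) n₁₂ ,
    trans (entry m≈n (# 2) (# 0)) n₂₀

  PsubShape-· : ∀ m n → PsubShape m → PsubShape n → PsubShape (m · n)
  PsubShape-· m n (m₁₀ , m₁₂ , m₂₀) (n₁₀ , n₁₂ , n₂₀) =
    sum-of-zeros (annihilateˡ m₁₀) (sum-of-zeros (annihilateʳ n₁₀) (annihilateʳ n₂₀)) ,
    sum-of-zeros (annihilateˡ m₁₀) (sum-of-zeros (annihilateʳ n₁₂) (annihilateˡ m₁₂)) ,
    sum-of-zeros (annihilateˡ m₂₀) (sum-of-zeros (annihilateʳ n₁₀) (annihilateʳ n₂₀))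

  InPsub-resp : ∀ {m n} → m ≈ₘ n → InPsub R n → InPsub R m
  InPsub-resp {n = n} m≈n ((n⁻ , nn⁻≈I , n⁻n≈I) , shape) =
    (n⁻ , entry (≈ₘ-trans (·-congʳ n⁻ m≈n) (entrywise {n · n⁻} {I} nn⁻≈I))
        , entry (≈ₘ-trans (·-congˡ n⁻ m≈n) (entrywise {n⁻ · n} {I} n⁻n≈I))) ,
    PsubShape-resp m≈n shape

  InPsub-conj : ∀ k k⁻ m → k · k⁻ ≈ₘ I → k⁻ · k ≈ₘ I → PsubShape k → PsubShape k⁻ →
                InPsub R m → InPsub R ((k⁻ · m) · k)
  InPsub-conj k k⁻ m kk⁻≈I k⁻k≈I k-shape k⁻-shape ((m⁻ , mm⁻≈I , m⁻m≈I) , m-shape) =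
    ((k⁻ · m⁻) · k , entry (conj-inverse k k⁻ m m⁻ kk⁻≈I k⁻k≈I (entrywise {m · m⁻} {I} mm⁻≈I))
                   , entry (conj-inverse k k⁻ m⁻ m kk⁻≈I k⁻k≈I (entrywise {m⁻ · m} {I} m⁻m≈I))) ,
    PsubShape-· (k⁻ · m) k (PsubShape-· k⁻ m k⁻-shape m-shape) k-shape

module GeneralLinear {c ℓ : Level} (R : CommutativeRing c ℓ) where
  open MatrixAlgebra R
  open Monoid monoid using () renaming (trans to ≈ₘ-trans)
  open MonoidProperties monoid using (cancelᶜ)
  open Conjugation monoid using (change-conjugator)
  open GL3

  right-inverse : ∀ (g : GL3 R) → mat g · inv g ≈ₘ I
  right-inverse g = entrywise {mat g · inv g} {I} (proj₁ (isInv g))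

  left-inverse : ∀ (g : GL3 R) → inv g · mat g ≈ₘ I
  left-inverse g = entrywise {inv g · mat g} {I} (proj₂ (isInv g))

  -- If the transporters g⁻¹h and h⁻¹g have the shape of P_sub, then
  -- g P_sub g⁻¹ ⊆ h P_sub h⁻¹: from g⁻¹xg ∈ P_sub we get
  -- h⁻¹xh = (h⁻¹g)(g⁻¹xg)(g⁻¹h) ∈ P_sub.
  conjugate-inclusion : ∀ (g h : GL3 R) → PsubShape (inv g · mat h) → PsubShape (inv h · mat g) →
                        ∀ x → InPsub R ((inv g · x) · mat g) → InPsub R ((inv h · x) · mat h)
  conjugate-inclusion g h k-shape k⁻-shape x g⁻¹xg∈Psub =
    InPsub-resp (change-conjugator (mat g) (inv g) (right-inverse g) (mat h) (inv h) x)
      (InPsub-conj (inv g · mat h) (inv h · mat g) ((inv g · x) · mat g)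
                   kk⁻≈I k⁻k≈I k-shape k⁻-shape g⁻¹xg∈Psub)
    where
    kk⁻≈I : (inv g · mat h) · (inv h · mat g) ≈ₘ I
    kk⁻≈I = ≈ₘ-trans (cancelᶜ {a = mat h} {c = inv h} (right-inverse h) (inv g) (mat g)) (left-inverse g)
    k⁻k≈I : (inv h · mat g) · (inv g · mat h) ≈ₘ I
    k⁻k≈I = ≈ₘ-trans (cancelᶜ {a = mat g} {c = inv g} (right-inverse g) (inv h) (mat h)) (left-inverse h)

module Lines {c ℓ : Level} (R : CommutativeRing c ℓ) where
  open CommutativeRing R
  open RingFacts R
  open MatrixAlgebra R
  open Monoid monoid using ()
    renaming (sym to ≈ₘ-sym; trans to ≈ₘ-trans; setoid to matSetoid)
  open Conjugation monoid using (unconjugateˡ; unconjugateʳ)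
  open GeneralLinear R using (left-inverse)
  open GL3

  adE : GL3 R → Mat
  adE g = (mat g · E) · inv g

  adE-recovers-E : ∀ (g : GL3 R) → (inv g · adE g) · mat g ≈ₘ E
  adE-recovers-E g = ≈ₘ-trans (unconjugateˡ (mat g) (inv g) (left-inverse g) E (mat g))
                              (≈ₘ-trans (·-congˡ E (left-inverse g)) (·-identityʳ E))

  adE-scalar-fixed : ∀ (g : GL3 R) t → adE g ≈ₘ t ⊛ adE g → 1# ≈ t
  adE-scalar-fixed g t fixed = trans (entry E≈tE (# 0) (# 1)) (*-identityʳ t)
    where
    open SetoidReasoning matSetoid
    E≈tE : E ≈ₘ t ⊛ E
    E≈tE = begin
      E                                    ≈⟨ ≈ₘ-sym (adE-recovers-E g) ⟩
      (inv g · adE g) · mat g              ≈⟨ ·-congʳ (mat g) (·-congˡ (inv g) fixed) ⟩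
      (inv g · (t ⊛ adE g)) · mat g        ≈⟨ ⊛-pull t (inv g) (adE g) (mat g) ⟩
      t ⊛ ((inv g · adE g) · mat g)        ≈⟨ ⊛-congˡ t (adE-recovers-E g) ⟩
      t ⊛ E                                ∎

  transporter-intertwines : ∀ (g h : GL3 R) {a} → adE h ≈ₘ a ⊛ adE g →
                            (inv g · mat h) · E ≈ₘ a ⊛ (E · (inv g · mat h))
  transporter-intertwines g h {a} adEh≈a·adEg = begin
    (inv g · mat h) · E
      ≈⟨ ≈ₘ-sym (unconjugateʳ (mat h) (inv h) (left-inverse h) E (inv g)) ⟩
    (inv g · adE h) · mat h
      ≈⟨ ·-congʳ (mat h) (·-congˡ (inv g) adEh≈a·adEg) ⟩
    (inv g · (a ⊛ adE g)) · mat h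
      ≈⟨ ⊛-pull a (inv g) (adE g) (mat h) ⟩
    a ⊛ ((inv g · adE g) · mat h)
      ≈⟨ ⊛-congˡ a (unconjugateˡ (mat g) (inv g) (left-inverse g) E (mat h)) ⟩
    a ⊛ (E · (inv g · mat h))
      ∎
    where open SetoidReasoning matSetoid

  -- Comparing entries of k E₁₂ = a E₁₂ k: column 1 gives k₁₀ = k₂₀ = 0 and
  -- entry (0,2) gives a k₁₂ = 0; so k has the shape of P_sub when a is a unit.
  intertwiner-shape : ∀ k a → IsUnit R a → k · E ≈ₘ a ⊛ (E · k) → PsubShape k
  intertwiner-shape k a a-unit kE≈aEk =
    k₁₀≈0 , unit-cancel a-unit ak₁₂≈0 , k₂₀≈0
    where
    -- Products with E₁₂ pick out the first entry of a row, the second entry of a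
    -- column, or nothing.
    first : ∀ x y z → x * 1# + (y * 0# + z * 0#) ≈ x
    first x y z = plus-zeros (*-identityʳ x) (sum-of-zeros (zeroʳ y) (zeroʳ z))

    second : ∀ x y z → 0# * x + (1# * y + 0# * z) ≈ y
    second x y z = zeros-plus (zeroˡ x) (plus-zeros (*-identityˡ y) (zeroˡ z))

    none : ∀ x y z → 0# * x + (0# * y + 0# * z) ≈ 0#
    none x y z = sum-of-zeros (zeroˡ x) (sum-of-zeros (zeroˡ y) (zeroˡ z))

    k₁₀≈0 : k (# 1) (# 0) ≈ 0#
    k₁₀≈0 = trans (sym (first _ _ _))
                  (trans (entry kE≈aEk (# 1) (# 1)) (annihilateʳ (none _ _ _)))

    k₂₀≈0 : k (# 2) (# 0) ≈ 0#
    k₂₀≈0 = trans (sym (first _ _ _))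
                  (trans (entry kE≈aEk (# 2) (# 1)) (annihilateʳ (none _ _ _)))

    ak₁₂≈0 : a * k (# 1) (# 2) ≈ 0#
    ak₁₂≈0 = trans (*-congˡ (sym (second _ _ _)))
                   (trans (sym (entry kE≈aEk (# 0) (# 2)))
                          (sum-of-zeros (zeroʳ _) (sum-of-zeros (zeroʳ _) (zeroʳ _))))

  equal-lines⇒transporter-shape : ∀ (g h : GL3 R) → _≐_ R (p₂ R g) (p₂ R h) →
                                  PsubShape (inv g · mat h)
  equal-lines⇒transporter-shape g h same =
    intertwiner-shape (inv g · mat h) a (b , sym ab≈1) (transporter-intertwines g h adEh≈a·adEg)
    where
    adEh∈p₂g : p₂ R g (adE h)
    adEh∈p₂g = proj₂ (same (adE h)) (1# , entry (⊛-identity (adE h)))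

    adEg∈p₂h : p₂ R h (adE g)
    adEg∈p₂h = proj₁ (same (adE g)) (1# , entry (⊛-identity (adE g)))

    a b : Carrier
    a = proj₁ adEh∈p₂g
    b = proj₁ adEg∈p₂h

    adEh≈a·adEg : adE h ≈ₘ a ⊛ adE g
    adEh≈a·adEg = entrywise (proj₂ adEh∈p₂g)

    adEg≈b·adEh : adE g ≈ₘ b ⊛ adE h
    adEg≈b·adEh = entrywise (proj₂ adEg∈p₂h)

    ab≈1 : 1# ≈ a * b
    ab≈1 = adE-scalar-fixed h (a * b)
      (≈ₘ-trans adEh≈a·adEg (≈ₘ-trans (⊛-congˡ a adEg≈b·adEh) (⊛-assoc a b (adE h))))

module BaseChange {c ℓ : Level} {A B : CommutativeRing c ℓ}
  {φ : CommutativeRing.Carrier A → CommutativeRing.Carrier B}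
  (φ-hom : IsRingHomomorphism (CommutativeRing.rawRing A) (CommutativeRing.rawRing B) φ) where
  private module MA = MatrixAlgebra A
  open MatrixAlgebra B
  open CommutativeRing B using (trans; +-cong)
  open Monoid monoid using () renaming (sym to ≈ₘ-sym; trans to ≈ₘ-trans)
  open IsRingHomomorphism φ-hom
  open GL3

  φₘ : MA.Mat → Mat
  φₘ = mapMat A B φ

  φₘ-cong : ∀ {m n} → m MA.≈ₘ n → φₘ m ≈ₘ φₘ n
  φₘ-cong p = entrywise λ i j → ⟦⟧-cong (MA.entry p i j)

  φₘ-· : ∀ m n → φₘ (m MA.· n) ≈ₘ φₘ m · φₘ n
  φₘ-· m n = entrywise λ i j →
    trans (+-homo _ _) (+-cong (*-homo _ _) (trans (+-homo _ _) (+-cong (*-homo _ _) (*-homo _ _))))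

  φₘ-I : φₘ MA.I ≈ₘ I
  φₘ-I = entrywise identity
    where
    identity : _≋_ B (φₘ MA.I) I
    identity zero             zero             = 1#-homo
    identity zero             (suc zero)       = 0#-homo
    identity zero             (suc (suc zero)) = 0#-homo
    identity (suc zero)       zero             = 0#-homo
    identity (suc zero)       (suc zero)       = 1#-homo
    identity (suc zero)       (suc (suc zero)) = 0#-homo
    identity (suc (suc zero)) zero             = 0#-homo
    identity (suc (suc zero)) (suc zero)       = 0#-homo
    identity (suc (suc zero)) (suc (suc zero)) = 1#-homo

  φₘ-shape : ∀ m → MA.PsubShape m → PsubShape (φₘ m)
  φₘ-shape m (m₁₀ , m₁₂ , m₂₀) =
    trans (⟦⟧-cong m₁₀) 0#-homo , trans (⟦⟧-cong m₁₂) 0#-homo , trans (⟦⟧-cong m₂₀) 0#-homo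

  φₘ-inverse : ∀ m n → _≋_ A (m MA.· n) MA.I → _≋_ B (φₘ m · φₘ n) I
  φₘ-inverse m n mn≈I =
    entry (≈ₘ-trans (≈ₘ-sym (φₘ-· m n))
                    (≈ₘ-trans (φₘ-cong (MA.entrywise {m MA.· n} {MA.I} mn≈I)) φₘ-I))

  φGL : GL3 A → GL3 B
  φGL g = record
    { mat   = φₘ (mat g)
    ; inv   = φₘ (inv g)
    ; isInv = φₘ-inverse (mat g) (inv g) (proj₁ (isInv g))
            , φₘ-inverse (inv g) (mat g) (proj₂ (isInv g))
    }

  φGL-transporter-shape : ∀ (g h : GL3 A) → MA.PsubShape (inv g MA.· mat h) →
                          PsubShape (inv (φGL g) · mat (φGL h))
  φGL-transporter-shape g h k-shape =
    PsubShape-resp (≈ₘ-sym (φₘ-· (inv g) (mat h))) (φₘ-shape (inv g MA.· mat h) k-shape)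

lemma7p9 : {c ℓ : Level} (A : CommutativeRing c ℓ) → IsLocal A →
    (P P' : GL3 A) → _≐_ A (p₂ A P) (p₂ A P') → SameParabolic A P P'
lemma7p9 A _ P P' same B φ φ-hom x =
  mk⇔ (conjugate-inclusion (φGL P) (φGL P') k-shape k⁻-shape x)
      (conjugate-inclusion (φGL P') (φGL P) k⁻-shape k-shape x)
  where
  open BaseChange φ-hom
  open GeneralLinear B using (conjugate-inclusion)
  open MatrixAlgebra B using (PsubShape; _·_)
  open Lines A using (equal-lines⇒transporter-shape)
  open GL3

  k-shape : PsubShape (inv (φGL P) · mat (φGL P'))
  k-shape = φGL-transporter-shape P P' (equal-lines⇒transporter-shape P P' same)

  k⁻-shape : PsubShape (inv (φGL P') · mat (φGL P))
  k⁻-shape = φGL-transporter-shape P' P (equal-lines⇒transporter-shape P' P (λ X → swap (same X)))
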